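{- Let $n,m\ge 3$ and $G=C_n\Box C_m$, with threshold $\tau(v)=3$ for every vertex $v$. Then every $\tau$-WDM of $G$ has processing time at most $2$ (i.e., the activation process ends after at most two steps). Moreover, if $4\mid n$, then $wdyn_\tau(C_n\Box C_n)\leq 3n^2/8$.
   Context: $C_n$ denotes the cycle on $n$ vertices and $\Box$ the Cartesian product of graphs. A set $D\subseteq V(G)$ is a $\tau$-weak dynamic monopoly ($\tau$-WDM) with processing time $t$ if $V(G)$ can be partitioned into nonempty sets $D_0=D,D_1,\ldots,D_t$ such that for every $i\in\{1,\ldots,t\}$, every vertex $v\in D_i$ has at least $\tau(v)$ neighbors in $D_{i-1}$. $wdyn_\tau(G)$ is the minimum size of a $\tau$-WDM. -}

module Defs where

open import Data.Nat using (ℕ; zero; suc; _+_; _≤_)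
open import Data.Nat.Properties using (_≟_)
open import Data.Fin using (Fin; toℕ; inject₁) renaming (suc to fsuc; zero to fzero)
open import Data.Bool using (Bool; true; false; _∧_; _∨_; if_then_else_)
open import Data.Product using (_×_; _,_; ∃)
open import Relation.Nullary.Decidable using (⌊_⌋)
open import Relation.Binary.PropositionalEquality using (_≡_)

countFin : ∀ {n} → (Fin n → Bool) → ℕ
countFin {zero}  p = 0
countFin {suc n} p = (if p fzero then 1 else 0) + countFin (λ i → p (fsuc i))

Vtx : ℕ → ℕ → Set
Vtx n m = Fin n × Fin m


countVtx : ∀ {n m} → (Vtx n m → Bool) → ℕ
countVtx {n} {m} p = sumFin (λ i → countFin (λ j → p (i , j)))
  where
  sumFin : ∀ {k} → (Fin k → ℕ) → ℕ
  sumFin {zero}  f = 0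
  sumFin {suc k} f = f fzero + sumFin (λ i → f (fsuc i))

succMod : ℕ → ℕ → ℕ
succMod n i = if ⌊ suc i ≟ n ⌋ then 0 else suc i

cycAdj : ∀ {n} → Fin n → Fin n → Bool
cycAdj {n} i j = ⌊ toℕ j ≟ succMod n (toℕ i) ⌋ ∨ ⌊ toℕ i ≟ succMod n (toℕ j) ⌋

torAdj : ∀ {n m} → Vtx n m → Vtx n m → Bool
torAdj (a , b) (c , d) =
  (⌊ toℕ a ≟ toℕ c ⌋ ∧ cycAdj b d) ∨ (⌊ toℕ b ≟ toℕ d ⌋ ∧ cycAdj a c)

finEq : ∀ {k} → Fin k → Fin k → Bool
finEq i j = ⌊ toℕ i ≟ toℕ j ⌋

-- A partition V = D_0 ∪ … ∪ D_t given by a layer map V → {0,…,t}, with every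
-- layer nonempty, such that each v ∈ D_i (i ≥ 1) has at least τ(v) neighbours in D_{i-1}.
record IsWDMPartition {n m : ℕ} (τ : Vtx n m → ℕ) (t : ℕ)
                      (layer : Vtx n m → Fin (suc t)) : Set where
  field
    nonempty : ∀ (i : Fin (suc t)) → ∃ λ v → layer v ≡ i
    activated : ∀ (v : Vtx n m) (i : Fin t) → layer v ≡ fsuc i →
      τ v ≤ countVtx (λ w → torAdj v w ∧ finEq (layer w) (inject₁ i))

IsWDMWithTime : ∀ {n m} → (Vtx n m → ℕ) → (Vtx n m → Bool) → ℕ → Set
IsWDMWithTime {n} {m} τ D t =
  ∃ λ (layer : Vtx n m → Fin (suc t)) →
    IsWDMPartition τ t layer × (∀ v → D v ≡ finEq (layer v) fzero)

IsWDM : ∀ {n m} → (Vtx n m → ℕ) → (Vtx n m → Bool) → Set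
IsWDM τ D = ∃ λ t → IsWDMWithTime τ D t

size : ∀ {n m} → (Vtx n m → Bool) → ℕ
size D = countVtx D

τ3 : ∀ {n m} → Vtx n m → ℕ
τ3 _ = 3

module Submission where

-- Suppose some vertex v lies in layer D_3.
-- Three of its four neighbours lie in D_2, so D_2 contains a vertical
-- neighbour a and a horizontal neighbour b of v.  Let c be the fourth
-- corner of the square spanned by v, a, b.  If c ∈ D_1, then c has at most
-- two neighbours in D_0 (its neighbours a, b are in D_2); otherwise a has at
-- most two neighbours in D_1 (its neighbours v ∈ D_3 and c ∉ D_1).  Either
-- way the threshold 3 fails.
--
-- For 4 ∣ n we lift a fixed 3-layer tile on
-- the 4 × 4 torus along the residue map (i , j) ↦ (i mod 4 , j mod 4), which
-- maps the neighbours of a vertex onto the neighbours of its image.  The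
-- tile is checked once by computation; it has 6 of its 16 cells in D_0.

open import Defs
open import Data.Bool using (Bool; true; false; _∧_; _∨_; if_then_else_)
open import Data.Bool.Properties using (∨-zeroʳ)
open import Data.Empty using (⊥-elim)
open import Data.Fin using (Fin; toℕ; inject₁; fromℕ<; #_) renaming (suc to fsuc; zero to fzero)
open import Data.Fin.Properties using (toℕ-injective; toℕ<n; toℕ-fromℕ<; toℕ-inject₁; all?)
  renaming (_≟_ to _≟ᶠ_; suc-injective to fsuc-injective)
open import Data.List using (List; []; _∷_; map; length)
open import Data.Nat.ListAction using () renaming (sum to listSum)
open import Data.List.Properties using (map-∘; map-cong-local)
open import Data.List.Relation.Unary.All using (All; []; _∷_)
open import Data.List.Relation.Unary.AllPairs using ([]; _∷_)
open import Data.List.Relation.Unary.Any using (here; there)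
open import Data.List.Membership.Propositional using (_∈_)
open import Data.List.Relation.Unary.Unique.Propositional using (Unique)
open import Data.Nat
open import Data.Nat.Divisibility using (_∣_; divides)
open import Data.Nat.Properties
open import Data.Nat.Tactic.RingSolver using (solve-∀)
open import Data.Product using (_×_; _,_; ∃; proj₁; proj₂)
open import Data.Product.Properties using (≡-dec)
open import Data.Sum using (_⊎_; inj₁; inj₂; swap)
open import Data.Vec using (Vec; lookup) renaming ([] to []ᵛ; _∷_ to _∷ᵛ_)
open import Function using (_∘_)
open import Relation.Binary.PropositionalEquality
open import Relation.Nullary using (Dec; yes; no; ¬_; contradiction)
open import Relation.Nullary.Decidable using (⌊_⌋; isYes≗does; dec-true; dec-false; from-yes; _→-dec_)

open import Algebra.Properties.Semiring.Sum +-*-semiring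
  using (sum; ∑-distrib-+; sum-cong-≗; *-distribˡ-sum)

ind : Bool → ℕ
ind b = if b then 1 else 0

∧-split : ∀ {a b} → a ∧ b ≡ true → a ≡ true × b ≡ true
∧-split {true} {true} _ = refl , refl

∨-split : ∀ {a b} → a ∨ b ≡ true → a ≡ true ⊎ b ≡ true
∨-split {true}  _ = inj₁ refl
∨-split {false} e = inj₂ e

witness : ∀ {A : Set} (a? : Dec A) → ⌊ a? ⌋ ≡ true → A
witness (yes a) _ = a

⌊⌋-true : ∀ {A : Set} (a? : Dec A) → A → ⌊ a? ⌋ ≡ true
⌊⌋-true a? a = trans (isYes≗does a?) (dec-true a? a)

⌊⌋-false : ∀ {A : Set} (a? : Dec A) → ¬ A → ⌊ a? ⌋ ≡ false
⌊⌋-false a? ¬a = trans (isYes≗does a?) (dec-false a? ¬a)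

sum-mono : ∀ {k} {f g : Fin k → ℕ} → (∀ i → f i ≤ g i) → sum f ≤ sum g
sum-mono {zero}  _ = z≤n
sum-mono {suc k} h = +-mono-≤ (h fzero) (sum-mono (h ∘ fsuc))

sum-zero : ∀ {k} (f : Fin k → ℕ) → (∀ i → f i ≡ 0) → sum f ≡ 0
sum-zero {zero}  f h = refl
sum-zero {suc k} f h = cong₂ _+_ (h fzero) (sum-zero (f ∘ fsuc) (h ∘ fsuc))

sum-support : ∀ {k} (f : Fin k → ℕ) (b : Fin k) → (∀ i → i ≢ b → f i ≡ 0) → sum f ≡ f b
sum-support f fzero h = begin
  f fzero + sum (f ∘ fsuc) ≡⟨ cong (f fzero +_) (sum-zero (f ∘ fsuc) (λ i → h (fsuc i) λ ())) ⟩
  f fzero + 0              ≡⟨ +-identityʳ _ ⟩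
  f fzero                  ∎
  where open ≡-Reasoning
sum-support f (fsuc b) h =
  trans (cong (_+ sum (f ∘ fsuc)) (h fzero λ ()))
        (sum-support (f ∘ fsuc) b (λ i i≢b → h (fsuc i) (i≢b ∘ fsuc-injective)))

countFin≡sum : ∀ {k} (p : Fin k → Bool) → countFin p ≡ sum (ind ∘ p)
countFin≡sum {zero}  p = refl
countFin≡sum {suc k} p = cong (ind (p fzero) +_) (countFin≡sum (p ∘ fsuc))

Σᵥ : ∀ {n m} → (Vtx n m → ℕ) → ℕ
Σᵥ {n} {m} f = sum {n} (λ i → sum {m} (λ j → f (i , j)))

countVtx≡Σᵥ : ∀ {n m} (p : Vtx n m → Bool) → countVtx p ≡ Σᵥ (ind ∘ p)
countVtx≡Σᵥ {zero}      p = refl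
countVtx≡Σᵥ {suc n} {m} p =
  cong₂ _+_ (countFin≡sum (λ j → p (fzero , j))) (countVtx≡Σᵥ {n} {m} (λ v → p (fsuc (proj₁ v) , proj₂ v)))

Σᵥ-mono : ∀ {n m} {f g : Vtx n m → ℕ} → (∀ v → f v ≤ g v) → Σᵥ f ≤ Σᵥ g
Σᵥ-mono {f = f} {g} h =
  sum-mono {f = λ i → sum (λ j → f (i , j))} {g = λ i → sum (λ j → g (i , j))}
           (λ i → sum-mono (λ j → h (i , j)))

Σᵥ-+ : ∀ {n m} (f g : Vtx n m → ℕ) → Σᵥ (λ v → f v + g v) ≡ Σᵥ f + Σᵥ g
Σᵥ-+ f g = trans (sum-cong-≗ (λ i → ∑-distrib-+ (λ j → f (i , j)) (λ j → g (i , j))))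
                 (∑-distrib-+ (λ i → sum (λ j → f (i , j))) (λ i → sum (λ j → g (i , j))))

Σᵥ-zero : ∀ {n m} → Σᵥ {n} {m} (λ _ → 0) ≡ 0
Σᵥ-zero {n} {m} = sum-zero {n} _ (λ i → sum-zero {m} (λ _ → 0) (λ _ → refl))

_≟ᵥ_ : ∀ {n m} (v w : Vtx n m) → Dec (v ≡ w)
_≟ᵥ_ = ≡-dec _≟ᶠ_ _≟ᶠ_

δ : ∀ {n m} → Vtx n m → Vtx n m → ℕ
δ x w = ind ⌊ w ≟ᵥ x ⌋

δ-self : ∀ {n m} (x : Vtx n m) → δ x x ≡ 1
δ-self x = cong ind (⌊⌋-true (x ≟ᵥ x) refl)

δ-other : ∀ {n m} {x w : Vtx n m} → w ≢ x → δ x w ≡ 0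
δ-other {x = x} {w} w≢x = cong ind (⌊⌋-false (w ≟ᵥ x) w≢x)

Σᵥ-support : ∀ {n m} (f : Vtx n m → ℕ) (x : Vtx n m) → (∀ w → w ≢ x → f w ≡ 0) → Σᵥ f ≡ f x
Σᵥ-support f (a , b) h =
  trans (sum-support _ a (λ i i≢a → sum-zero _ (λ j → h (i , j) (i≢a ∘ cong proj₁))))
        (sum-support _ b (λ j j≢b → h (a , j) (j≢b ∘ cong proj₂)))

Σᵥ-δ : ∀ {n m} (x : Vtx n m) (c : ℕ) → Σᵥ (λ w → δ x w * c) ≡ c
Σᵥ-δ x c = begin
  Σᵥ (λ w → δ x w * c) ≡⟨ Σᵥ-support _ x (λ w w≢x → cong (_* c) (δ-other w≢x)) ⟩
  δ x x * c            ≡⟨ cong (_* c) (δ-self x) ⟩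
  1 * c                ≡⟨ *-identityˡ c ⟩
  c                    ∎
  where open ≡-Reasoning

-- Weighting the indicators of the vertices of a list: the total mass is the
-- total weight.  This is the bridge between counting and list sums.
Σᵥ-weighted : ∀ {n m} (xs : List (Vtx n m)) (c : Vtx n m → ℕ) →
              Σᵥ (λ w → listSum (map (λ x → δ x w * c x) xs)) ≡ listSum (map c xs)
Σᵥ-weighted {n} {m} [] c = Σᵥ-zero {n} {m}
Σᵥ-weighted (x ∷ xs) c =
  trans (Σᵥ-+ (λ w → δ x w * c x) _) (cong₂ _+_ (Σᵥ-δ x (c x)) (Σᵥ-weighted xs c))

count-upper : ∀ {n m} (P : Vtx n m → Bool) (xs : List (Vtx n m)) →
              (∀ w → P w ≡ true → w ∈ xs) → countVtx P ≤ length xs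
count-upper P xs covers = begin
  countVtx P                                            ≡⟨ countVtx≡Σᵥ P ⟩
  Σᵥ (ind ∘ P)                                          ≤⟨ Σᵥ-mono pointwise ⟩
  Σᵥ (λ w → listSum (map (λ x → δ x w * 1) xs))         ≡⟨ Σᵥ-weighted xs (λ _ → 1) ⟩
  listSum (map (λ _ → 1) xs)                            ≡⟨ ones xs ⟩
  length xs                                             ∎
  where
  open ≤-Reasoning
  ones : ∀ ys → listSum (map (λ (_ : Vtx _ _) → 1) ys) ≡ length ys
  ones []       = refl
  ones (_ ∷ ys) = cong suc (ones ys)
  hit : ∀ {w} ys → w ∈ ys → 1 ≤ listSum (map (λ x → δ x w * 1) ys)
  hit (y ∷ ys) (here refl) = ≤-trans (≤-reflexive (sym (cong (_* 1) (δ-self y)))) (m≤m+n _ _)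
  hit (y ∷ ys) (there w∈ys) = ≤-trans (hit ys w∈ys) (m≤n+m _ _)
  pointwise : ∀ w → ind (P w) ≤ listSum (map (λ x → δ x w * 1) xs)
  pointwise w with P w in e
  ... | false = z≤n
  ... | true  = hit xs (covers w e)

count-lower : ∀ {n m} (Q : Vtx n m → Bool) (xs : List (Vtx n m)) → Unique xs →
              listSum (map (ind ∘ Q) xs) ≤ countVtx Q
count-lower Q xs unique = begin
  listSum (map (ind ∘ Q) xs)                               ≡⟨ Σᵥ-weighted xs (ind ∘ Q) ⟨
  Σᵥ (λ w → listSum (map (λ x → δ x w * ind (Q x)) xs))    ≤⟨ Σᵥ-mono (λ w → packed w xs unique) ⟩
  Σᵥ (ind ∘ Q)                                             ≡⟨ countVtx≡Σᵥ Q ⟨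
  countVtx Q                                               ∎
  where
  open ≤-Reasoning
  missed : ∀ w ys → All (w ≢_) ys → listSum (map (λ x → δ x w * ind (Q x)) ys) ≡ 0
  missed w []       []           = refl
  missed w (y ∷ ys) (w≢y ∷ w∉ys) =
    cong₂ _+_ (cong (_* ind (Q y)) (δ-other w≢y)) (missed w ys w∉ys)
  packed : ∀ w ys → Unique ys → listSum (map (λ x → δ x w * ind (Q x)) ys) ≤ ind (Q w)
  packed w []       []             = z≤n
  packed w (y ∷ ys) (y∉ys ∷ unique) with w ≟ᵥ y
  ... | yes refl = ≤-reflexive (trans (cong₂ _+_ (+-identityʳ _) (missed w ys y∉ys)) (+-identityʳ _))
  ... | no _     = packed w ys unique

data Dir : Set where
  fwd bwd : Dir

opposite : Dir → Dir
opposite fwd = bwd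
opposite bwd = fwd

dir-cases : ∀ d d′ → d′ ≡ d ⊎ d′ ≡ opposite d
dir-cases fwd fwd = inj₁ refl
dir-cases fwd bwd = inj₂ refl
dir-cases bwd fwd = inj₂ refl
dir-cases bwd bwd = inj₁ refl

predMod : ℕ → ℕ → ℕ
predMod n zero    = n ∸ 1
predMod n (suc x) = x

shift : Dir → ℕ → ℕ → ℕ
shift fwd = succMod
shift bwd = predMod

shift-< : ∀ d {n x} → x < n → shift d n x < n
shift-< fwd {n} {x} x<n with suc x ≟ n
... | yes _  = ≤-trans (s≤s z≤n) x<n
... | no x+1≢n = ≤∧≢⇒< x<n x+1≢n
shift-< bwd {suc n} {zero}  _   = ≤-refl
shift-< bwd {n}     {suc x} x<n = <-trans (n<1+n x) x<n

shift-opposite : ∀ d {n x} → x < n → shift (opposite d) n (shift d n x) ≡ x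
shift-opposite fwd {n} {x} _ with suc x ≟ n
... | yes refl = refl
... | no _     = refl
shift-opposite bwd {suc n} {zero} _ with suc n ≟ suc n
... | yes _ = refl
... | no n≢n = contradiction refl n≢n
shift-opposite bwd {n} {suc x} x<n with suc x ≟ n
... | yes x+1≡n = contradiction x+1≡n (<⇒≢ x<n)
... | no _      = refl

succMod-moves : ∀ {n x} → 2 ≤ n → succMod n x ≢ x
succMod-moves {n} {x} 2≤n with suc x ≟ n
succMod-moves {x = zero}  (s≤s ()) | yes refl
succMod-moves {x = suc x} _        | yes refl = λ ()
... | no _ = 1+n≢n

succMod²-moves : ∀ {n x} → 3 ≤ n → succMod n (succMod n x) ≢ x
succMod²-moves {n} {x} 3≤n with suc x ≟ n
succMod²-moves {x = zero}        (s≤s ())       | yes refl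
succMod²-moves {x = suc zero}    (s≤s (s≤s ())) | yes refl
succMod²-moves {x = suc (suc x)} _              | yes refl = λ ()
... | no _ with suc (suc x) ≟ n
succMod²-moves {x = zero}  (s≤s (s≤s ())) | no _ | yes refl
succMod²-moves {x = suc x} _              | no _ | yes refl = λ ()
... | no _ = λ x+2≡x → <⇒≢ (m<n⇒m<1+n (n<1+n x)) (sym x+2≡x)

step : ∀ {n} → Dir → Fin n → Fin n
step d i = fromℕ< (shift-< d (toℕ<n i))

toℕ-step : ∀ {n} d (i : Fin n) → toℕ (step d i) ≡ shift d n (toℕ i)
toℕ-step d i = toℕ-fromℕ< (shift-< d (toℕ<n i))

step-opposite : ∀ {n} d (i : Fin n) → step (opposite d) (step d i) ≡ i
step-opposite {n} d i = toℕ-injective (begin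
  toℕ (step (opposite d) (step d i))   ≡⟨ toℕ-step (opposite d) (step d i) ⟩
  shift (opposite d) n (toℕ (step d i)) ≡⟨ cong (shift (opposite d) n) (toℕ-step d i) ⟩
  shift (opposite d) n (shift d n (toℕ i)) ≡⟨ shift-opposite d (toℕ<n i) ⟩
  toℕ i                                ∎)
  where open ≡-Reasoning

step-moves : ∀ {n} → 2 ≤ n → ∀ d (i : Fin n) → step d i ≢ i
step-moves 2≤n fwd i e = succMod-moves 2≤n (trans (sym (toℕ-step fwd i)) (cong toℕ e))
step-moves 2≤n bwd i e =
  step-moves 2≤n fwd i (trans (cong (step fwd) (sym e)) (step-opposite bwd i))

fwd≢bwd : ∀ {n} → 3 ≤ n → (i : Fin n) → step fwd i ≢ step bwd i
fwd≢bwd {n} 3≤n i e = succMod²-moves 3≤n (begin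
  succMod n (succMod n (toℕ i))     ≡⟨ cong (succMod n) (toℕ-step fwd i) ⟨
  succMod n (toℕ (step fwd i))      ≡⟨ toℕ-step fwd (step fwd i) ⟨
  toℕ (step fwd (step fwd i))       ≡⟨ cong (toℕ ∘ step fwd) e ⟩
  toℕ (step fwd (step bwd i))       ≡⟨ cong toℕ (step-opposite bwd i) ⟩
  toℕ i                             ∎)
  where open ≡-Reasoning

cycAdj-step : ∀ {n} (i j : Fin n) → cycAdj i j ≡ true → ∃ λ d → j ≡ step d i
cycAdj-step {n} i j e with ∨-split {⌊ toℕ j ≟ succMod n (toℕ i) ⌋} e
... | inj₁ j-next = fwd , toℕ-injective (trans (witness _ j-next) (sym (toℕ-step fwd i)))
... | inj₂ i-next = bwd , (begin
  j                    ≡⟨ step-opposite fwd j ⟨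
  step bwd (step fwd j) ≡⟨ cong (step bwd) (toℕ-injective (trans (toℕ-step fwd j) (sym (witness _ i-next)))) ⟩
  step bwd i           ∎)
  where open ≡-Reasoning

step-adjacent : ∀ {n} d (i : Fin n) → cycAdj i (step d i) ≡ true
step-adjacent {n} fwd i
  rewrite ⌊⌋-true (toℕ (step fwd i) ≟ succMod n (toℕ i)) (toℕ-step fwd i) = refl
step-adjacent {n} bwd i
  rewrite ⌊⌋-true (toℕ i ≟ succMod n (toℕ (step bwd i)))
                  (trans (cong toℕ (sym (step-opposite bwd i))) (toℕ-step fwd (step bwd i)))
  = ∨-zeroʳ _

torAdj-cases : ∀ {n m} (i : Fin n) (j : Fin m) (w : Vtx n m) → torAdj (i , j) w ≡ true →
               (∃ λ d → w ≡ (step d i , j)) ⊎ (∃ λ d → w ≡ (i , step d j))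
torAdj-cases i j (k , l) e with ∨-split {⌊ toℕ i ≟ toℕ k ⌋ ∧ cycAdj j l} e
... | inj₁ same-row with ∧-split same-row
...   | i≡k , j~l with cycAdj-step j l j~l
...     | d , refl = inj₂ (d , cong (_, step d j) (sym (toℕ-injective (witness _ i≡k))))
torAdj-cases i j (k , l) e | inj₂ same-column with ∧-split same-column
...   | j≡l , i~k with cycAdj-step i k i~k
...     | d , refl = inj₁ (d , cong (step d i ,_) (sym (toℕ-injective (witness _ j≡l))))

neighbours : ∀ {n m} → Vtx n m → List (Vtx n m)
neighbours (i , j) = (step fwd i , j) ∷ (step bwd i , j) ∷ (i , step fwd j) ∷ (i , step bwd j) ∷ []

neighbours-adjacent : ∀ {n m} (v : Vtx n m) → All (λ w → torAdj v w ≡ true) (neighbours v)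
neighbours-adjacent {n} {m} (i , j) = vertical fwd ∷ vertical bwd ∷ horizontal fwd ∷ horizontal bwd ∷ []
  where
  vertical : ∀ d → torAdj (i , j) (step d i , j) ≡ true
  vertical d rewrite ⌊⌋-true (toℕ j ≟ toℕ j) refl | step-adjacent d i = ∨-zeroʳ _
  horizontal : ∀ d → torAdj (i , j) (i , step d j) ≡ true
  horizontal d rewrite ⌊⌋-true (toℕ i ≟ toℕ i) refl | step-adjacent d j = refl

neighbours-unique : ∀ {n m} → 3 ≤ n → 3 ≤ m → (v : Vtx n m) → Unique (neighbours v)
neighbours-unique 3≤n 3≤m (i , j) =
    (vertical-apart ∷ vertical-moves fwd ∷ vertical-moves fwd ∷ [])
  ∷ (vertical-moves bwd ∷ vertical-moves bwd ∷ [])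
  ∷ (horizontal-apart ∷ [])
  ∷ []
  ∷ []
  where
  2≤n = ≤-trans (n≤1+n 2) 3≤n
  vertical-apart : (step fwd i , j) ≢ (step bwd i , j)
  vertical-apart = fwd≢bwd 3≤n i ∘ cong proj₁
  horizontal-apart : (i , step fwd j) ≢ (i , step bwd j)
  horizontal-apart = fwd≢bwd 3≤m j ∘ cong proj₂
  vertical-moves : ∀ d {l} → (step d i , j) ≢ (i , l)
  vertical-moves d = step-moves 2≤n d i ∘ cong proj₁

neighbour-count : ∀ {n m} → 3 ≤ n → 3 ≤ m → (v : Vtx n m) (P : Vtx n m → Bool) →
                  listSum (map (ind ∘ P) (neighbours v)) ≤ countVtx (λ w → torAdj v w ∧ P w)
neighbour-count 3≤n 3≤m v P = begin
  listSum (map (ind ∘ P) (neighbours v))                    ≡⟨ cong listSum (map-cong-local (adjacent (neighbours-adjacent v))) ⟩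
  listSum (map (ind ∘ (λ w → torAdj v w ∧ P w)) (neighbours v)) ≤⟨ count-lower _ (neighbours v) (neighbours-unique 3≤n 3≤m v) ⟩
  countVtx (λ w → torAdj v w ∧ P w)                          ∎
  where
  open ≤-Reasoning
  adjacent : ∀ {ws} → All (λ w → torAdj v w ≡ true) ws → All (λ w → ind (P w) ≡ ind (torAdj v w ∧ P w)) ws
  adjacent []             = []
  adjacent (v~w ∷ others) = cong (λ b → ind (b ∧ _)) (sym v~w) ∷ adjacent others

module Layering {n m t : ℕ} (layer : Vtx n m → Fin (suc t)) (wdm : IsWDMPartition τ3 t layer) where
  open IsWDMPartition wdm

  level : Vtx n m → ℕ
  level w = toℕ (layer w)

  inLevel : ℕ → Vtx n m → Bool
  inLevel k w = ⌊ level w ≟ k ⌋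

  same-level : ∀ {w x k l} → w ≡ x → inLevel k w ≡ true → inLevel l x ≡ true → k ≡ l
  same-level {w} {k = k} {l} refl w∈k w∈l = trans (sym (witness (level w ≟ k) w∈k)) (witness (level w ≟ l) w∈l)

  activation : ∀ {k} → k < t → ∀ v → level v ≡ suc k →
               3 ≤ countVtx (λ w → torAdj v w ∧ inLevel k w)
  activation {k} k<t v lv =
    subst (λ l → 3 ≤ countVtx (λ w → torAdj v w ∧ ⌊ level w ≟ l ⌋)) toℕ-i≡k
          (activated v i (toℕ-injective (trans lv (cong suc (sym (toℕ-fromℕ< k<t))))))
    where
    i = fromℕ< k<t
    toℕ-i≡k : toℕ (inject₁ i) ≡ k
    toℕ-i≡k = trans (toℕ-inject₁ i) (toℕ-fromℕ< k<t)

  starved : ∀ {k} → k < t → ∀ v c d →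
            (∀ w → (torAdj v w ∧ inLevel k w) ≡ true → w ∈ c ∷ d ∷ []) → level v ≢ suc k
  starved k<t v c d only lv = ≤⇒≯ (count-upper _ (c ∷ d ∷ []) only) (activation k<t v lv)

  along : ∀ {k} → k < t → ∀ v (x y : Dir → Vtx n m) → level v ≡ suc k →
          (∀ w → torAdj v w ≡ true → (∃ λ d → w ≡ x d) ⊎ (∃ λ d → w ≡ y d)) →
          ∃ λ d → inLevel k (x d) ≡ true
  along {k} k<t v x y lv split with inLevel k (x fwd) in x₁ | inLevel k (x bwd) in x₂
  ... | true  | _     = fwd , x₁
  ... | false | true  = bwd , x₂
  ... | false | false = ⊥-elim (starved k<t v (y fwd) (y bwd) only-y lv)
    where
    only-y : ∀ w → (torAdj v w ∧ inLevel k w) ≡ true → w ∈ y fwd ∷ y bwd ∷ []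
    only-y w e with ∧-split {torAdj v w} e
    ... | v~w , w∈k with split w v~w
    ... | inj₁ (fwd , refl) = contradiction (trans (sym w∈k) x₁) λ ()
    ... | inj₁ (bwd , refl) = contradiction (trans (sym w∈k) x₂) λ ()
    ... | inj₂ (fwd , w≡y) = here w≡y
    ... | inj₂ (bwd , w≡y) = there (here w≡y)

  -- The square argument: a vertex at level 3 would have a vertical and a
  -- horizontal neighbour at level 2, and the fourth corner of the square they
  -- span starves either itself or the vertical neighbour.
  no-level-three : 2 < t → ∀ v → level v ≢ 3
  no-level-three 2<t (i , j) lv
    with along 2<t (i , j) (λ d → step d i , j) (λ d → i , step d j) lv (torAdj-cases i j)
       | along 2<t (i , j) (λ d → i , step d j) (λ d → step d i , j) lv (λ w → swap ∘ torAdj-cases i j w)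
  ... | d , a∈2 | e , b∈2 with inLevel 1 (step d i , step e j) in corner∈1
  ... | true  = starved 0<t corner _ _ corner-fed (witness (level corner ≟ 1) corner∈1)
    where
    0<t = <-trans z<s (<-trans (s≤s z<s) 2<t)
    corner = (step d i , step e j)
    corner-fed : ∀ w → (torAdj corner w ∧ inLevel 0 w) ≡ true →
                 w ∈ (step d (step d i) , step e j) ∷ (step d i , step e (step e j)) ∷ []
    corner-fed w fed with ∧-split {torAdj corner w} fed
    ... | corner~w , w∈0 with torAdj-cases (step d i) (step e j) w corner~w
    ... | inj₁ (d′ , refl) with dir-cases d d′
    ...   | inj₁ refl = here refl
    ...   | inj₂ refl = contradiction (same-level (cong (_, step e j) (step-opposite d i)) w∈0 b∈2) λ ()
    corner-fed w fed | corner~w , w∈0 | inj₂ (e″ , refl) with dir-cases e e″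
    ...   | inj₁ refl = there (here refl)
    ...   | inj₂ refl = contradiction (same-level (cong (step d i ,_) (step-opposite e j)) w∈0 a∈2) λ ()
  ... | false = starved 1<t (step d i , j) _ _ vertical-fed (witness (level (step d i , j) ≟ 2) a∈2)
    where
    1<t = <-trans (s≤s z<s) 2<t
    v∈3 : inLevel 3 (i , j) ≡ true
    v∈3 = ⌊⌋-true (level (i , j) ≟ 3) lv
    vertical-fed : ∀ w → (torAdj (step d i , j) w ∧ inLevel 1 w) ≡ true →
                   w ∈ (step d (step d i) , j) ∷ (step d i , step (opposite e) j) ∷ []
    vertical-fed w fed with ∧-split {torAdj (step d i , j) w} fed
    ... | a~w , w∈1 with torAdj-cases (step d i) j w a~w
    ... | inj₁ (d′ , refl) with dir-cases d d′
    ...   | inj₁ refl = here refl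
    ...   | inj₂ refl = contradiction (same-level (cong (_, j) (step-opposite d i)) w∈1 v∈3) λ ()
    vertical-fed w fed | a~w , w∈1 | inj₂ (e″ , refl) with dir-cases e e″
    ...   | inj₁ refl = contradiction (trans (sym w∈1) corner∈1) λ ()
    ...   | inj₂ refl = there (here refl)

processing-time≤2 : ∀ {n m} (D : Vtx n m → Bool) (t : ℕ) → IsWDMWithTime τ3 D t → t ≤ 2
processing-time≤2 D t (layer , wdm , _) = ≮⇒≥ λ 2<t →
  let (v , v∈3) = nonempty (fromℕ< (s≤s 2<t))
  in  no-level-three 2<t v (trans (cong toℕ v∈3) (toℕ-fromℕ< (s≤s 2<t)))
  where
  open Layering layer wdm
  open IsWDMPartition wdm

-- Part 2.  Residues modulo 4, computed so that they reduce on numerals.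
mod4 : ℕ → Fin 4
mod4 0                     = # 0
mod4 1                     = # 1
mod4 2                     = # 2
mod4 3                     = # 3
mod4 (suc (suc (suc (suc x)))) = mod4 x

mod4-suc : ∀ x → mod4 (suc x) ≡ step fwd (mod4 x)
mod4-suc 0                     = refl
mod4-suc 1                     = refl
mod4-suc 2                     = refl
mod4-suc 3                     = refl
mod4-suc (suc (suc (suc (suc x)))) = mod4-suc x

mod4-multiple : ∀ q → mod4 (q * 4) ≡ # 0
mod4-multiple zero    = refl
mod4-multiple (suc q) = mod4-multiple q

mod4-step : ∀ {n} → mod4 n ≡ # 0 → ∀ d (i : Fin n) → mod4 (toℕ (step d i)) ≡ step d (mod4 (toℕ i))
mod4-step {n} n≡0 fwd i = trans (cong mod4 (toℕ-step fwd i)) (wraps (toℕ i))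
  where
  wraps : ∀ x → mod4 (succMod n x) ≡ step fwd (mod4 x)
  wraps x with suc x ≟ n
  ... | yes refl = sym (trans (sym (mod4-suc x)) n≡0)
  ... | no _     = mod4-suc x
mod4-step {n} n≡0 bwd i = begin
  mod4 (toℕ (step bwd i))                       ≡⟨ step-opposite fwd _ ⟨
  step bwd (step fwd (mod4 (toℕ (step bwd i)))) ≡⟨ cong (step bwd) (mod4-step n≡0 fwd (step bwd i)) ⟨
  step bwd (mod4 (toℕ (step fwd (step bwd i)))) ≡⟨ cong (step bwd ∘ mod4 ∘ toℕ) (step-opposite bwd i) ⟩
  step bwd (mod4 (toℕ i))                       ∎
  where open ≡-Reasoning

Cell : Set
Cell = Vtx 4 4

residue : ∀ {n} → Vtx n n → Cell
residue (i , j) = mod4 (toℕ i) , mod4 (toℕ j)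

residue-neighbours : ∀ {n} → mod4 n ≡ # 0 → (v : Vtx n n) → map residue (neighbours v) ≡ neighbours (residue v)
residue-neighbours n≡0 (i , j)
  rewrite mod4-step n≡0 fwd i | mod4-step n≡0 bwd i | mod4-step n≡0 fwd j | mod4-step n≡0 bwd j = refl

tile : Cell → Fin 3
tile (r , s) = lookup (lookup rows r) s
  where
  rows : Vec (Vec (Fin 3) 4) 4
  rows = (# 0 ∷ᵛ # 1 ∷ᵛ # 0 ∷ᵛ # 1 ∷ᵛ []ᵛ)
      ∷ᵛ (# 1 ∷ᵛ # 0 ∷ᵛ # 1 ∷ᵛ # 2 ∷ᵛ []ᵛ)
      ∷ᵛ (# 0 ∷ᵛ # 1 ∷ᵛ # 0 ∷ᵛ # 1 ∷ᵛ []ᵛ)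
      ∷ᵛ (# 1 ∷ᵛ # 2 ∷ᵛ # 1 ∷ᵛ # 0 ∷ᵛ []ᵛ)
      ∷ᵛ []ᵛ

inTile : Fin 2 → Cell → Bool
inTile k c = finEq (tile c) (inject₁ k)

tile-activates : ∀ r s (k : Fin 2) → tile (r , s) ≡ fsuc k →
                 3 ≤ listSum (map (ind ∘ inTile k) (neighbours (r , s)))
tile-activates = from-yes (all? λ r → all? λ s → all? λ k →
  (tile (r , s) ≟ᶠ fsuc k) →-dec (3 ≤? listSum (map (ind ∘ inTile k) (neighbours (r , s)))))

sum-periodic : ∀ q (F : Fin 4 → ℕ) → sum {q * 4} (λ a → F (mod4 (toℕ a))) ≡ q * sum F
sum-periodic zero    F = refl
sum-periodic (suc q) F = trans (regroup (F (# 0)) (F (# 1)) (F (# 2)) (F (# 3)) _)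
                               (cong (sum F +_) (sum-periodic q F))
  where
  regroup : ∀ a b c d x → a + (b + (c + (d + x))) ≡ a + (b + (c + (d + 0))) + x
  regroup = solve-∀

module Lift (q : ℕ) where
  n : ℕ
  n = suc q * 4

  n≡0 : mod4 n ≡ # 0
  n≡0 = mod4-multiple (suc q)

  layering : Vtx n n → Fin 3
  layering = tile ∘ residue

  D : Vtx n n → Bool
  D v = finEq (layering v) fzero

  -- The activation property lifts: the neighbours of v map onto those of its
  -- cell, and there are at least three of them in the right layer.
  activates : ∀ v (k : Fin 2) → layering v ≡ fsuc k →
              3 ≤ countVtx (λ w → torAdj v w ∧ finEq (layering w) (inject₁ k))
  activates v k v∈k+1 = begin
    3                                                             ≤⟨ tile-activates (proj₁ (residue v)) (proj₂ (residue v)) k v∈k+1 ⟩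
    listSum (map (ind ∘ inTile k) (neighbours (residue v)))       ≡⟨ cong (listSum ∘ map (ind ∘ inTile k)) (residue-neighbours n≡0 v) ⟨
    listSum (map (ind ∘ inTile k) (map residue (neighbours v)))   ≡⟨ cong listSum (map-∘ {g = ind ∘ inTile k} {f = residue} (neighbours v)) ⟨
    listSum (map (ind ∘ inTile k ∘ residue) (neighbours v))       ≤⟨ neighbour-count 3≤n 3≤n v (inTile k ∘ residue) ⟩
    countVtx (λ w → torAdj v w ∧ finEq (layering w) (inject₁ k))  ∎
    where
    open ≤-Reasoning
    3≤n : 3 ≤ n
    3≤n = s≤s (s≤s (s≤s z≤n))

  is-wdm : IsWDM τ3 D
  is-wdm = 2 , layering , record { nonempty = occupied ; activated = activates } , λ v → refl
    where
    occupied : ∀ l → ∃ λ v → layering v ≡ l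
    occupied fzero               = (# 0 , # 0) , refl
    occupied (fsuc fzero)        = (# 0 , # 1) , refl
    occupied (fsuc (fsuc fzero)) = (# 1 , # 3) , refl

  -- Each 4 × 4 block contributes its 6 cells of layer 0.
  size-D : size D ≡ suc q * (suc q * 6)
  size-D = begin
    size D                                                            ≡⟨ countVtx≡Σᵥ D ⟩
    sum {n} (λ a → sum {n} (λ b → block (mod4 (toℕ a)) (mod4 (toℕ b)))) ≡⟨ sum-cong-≗ {n} (λ a → sum-periodic (suc q) (block (mod4 (toℕ a)))) ⟩
    sum {n} (λ a → suc q * sum (block (mod4 (toℕ a))))                ≡⟨ sum-periodic (suc q) (λ r → suc q * sum (block r)) ⟩
    suc q * sum (λ r → suc q * sum (block r))                         ≡⟨ cong (suc q *_) (*-distribˡ-sum (suc q) (sum ∘ block)) ⟨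
    suc q * (suc q * 6)                                               ∎
    where
    open ≡-Reasoning
    block : Fin 4 → Fin 4 → ℕ
    block r s = ind (finEq (tile (r , s)) fzero)

  sparse : 8 * size D ≤ 3 * (n * n)
  sparse = ≤-reflexive (trans (cong (8 *_) size-D) (arith (suc q)))
    where
    arith : ∀ p → 8 * (p * (p * 6)) ≡ 3 * (p * 4 * (p * 4))
    arith = solve-∀

small-wdm : ∀ n → 3 ≤ n → 4 ∣ n →
            ∃ λ (D : Vtx n n → Bool) → IsWDM (τ3 {n} {n}) D × 8 * size D ≤ 3 * (n * n)
small-wdm .(0 * 4)     ()  (divides zero    refl)
small-wdm .(suc q * 4) _   (divides (suc q) refl) = D , is-wdm , sparse
  where open Lift q

theorem9 :
    (∀ (n m : ℕ) → 3 ≤ n → 3 ≤ m → ∀ (D : Vtx n m → Bool) (t : ℕ) →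
       IsWDMWithTime (τ3 {n} {m}) D t → t ≤ 2)
    × (∀ (n : ℕ) → 3 ≤ n → 4 ∣ n →
       ∃ λ (D : Vtx n n → Bool) → IsWDM (τ3 {n} {n}) D × 8 * size D ≤ 3 * (n * n))
theorem9 = (λ n m _ _ → processing-time≤2) , small-wdm
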